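{- Let $G_1$ and $G_2$ be Hadamard diagonalizable graphs. Then the lexicographic product $G_1\wr G_2$ is Hadamard diagonalizable.
   Context: Graphs are finite and simple. A (real) Hadamard matrix of order $n$ is an $n\times n$ matrix with entries in $\{1,-1\}$ such that $H^TH=nI$. The Laplacian matrix $L$ of a graph $G$ is defined by $L_{uu}=\deg(u)$, $L_{uv}=-1$ if $u\neq v$ are adjacent, and $L_{uv}=0$ otherwise. $G$ is Hadamard diagonalizable if there is a Hadamard matrix $H$ of order $n=|V(G)|$ such that $\frac1n H^TLH$ is diagonal. The lexicographic product $G_1\wr G_2$ has vertex set $V(G_1)\times V(G_2)$, with $(u,x)$ adjacent to $(v,y)$ if and only if either $uv\in E(G_1)$, or $u=v$ and $xy\in E(G_2)$ (i.e., each vertex of $G_1$ is replaced by a copy of $G_2$ and all edges are added between copies corresponding to adjacent vertices of $G_1$). -}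

module Defs where

open import Data.Nat using (ℕ; zero; suc)
import Data.Nat as ℕ
open import Data.Fin using (Fin; zero; suc; remQuot)
open import Data.Bool using (Bool; true; false; _∨_; _∧_; if_then_else_)
open import Data.Integer using (ℤ; +_; -_; _+_; _*_; _-_)
open import Data.Product using (_×_; _,_; proj₁; proj₂; Σ)
open import Data.Sum using (_⊎_)
open import Relation.Binary.PropositionalEquality using (_≡_; _≢_)
open import Relation.Nullary using (¬_)
open import Data.Fin using (_≟_)
open import Relation.Nullary.Decidable using (⌊_⌋)

record Graph (n : ℕ) : Set where
  field
    adj   : Fin n → Fin n → Bool
    adj-sym : ∀ u v → adj u v ≡ adj v u
    adj-irrefl : ∀ u → adj u u ≡ false
open Graph public

Matrix : ℕ → Set
Matrix n = Fin n → Fin n → ℤ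

∑ : ∀ {n} → (Fin n → ℤ) → ℤ
∑ {zero}  f = + 0
∑ {suc n} f = f zero + ∑ {n} (λ i → f (suc i))

transpose : ∀ {n} → Matrix n → Matrix n
transpose A i j = A j i

_⊗_ : ∀ {n} → Matrix n → Matrix n → Matrix n
(A ⊗ B) i j = ∑ (λ k → A i k * B k j)

degree : ∀ {n} → Graph n → Fin n → ℕ
degree {zero}  G u = 0
degree {suc n} G u = go (adj G u)
  where
  go : ∀ {m} → (Fin m → Bool) → ℕ
  go {zero}  f = 0
  go {suc m} f = (if f zero then 1 else 0) ℕ.+ go (λ i → f (suc i))

laplacian : ∀ {n} → Graph n → Matrix n
laplacian G u v with u ≟ v
... | Relation.Nullary.yes _ = + degree G u
... | Relation.Nullary.no _  = if adj G u v then - (+ 1) else + 0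

IsHadamard : ∀ {n} → Matrix n → Set
IsHadamard {n} H =
  (∀ i j → (H i j ≡ + 1) ⊎ (H i j ≡ - (+ 1))) ×
  (∀ i j → (transpose H ⊗ H) i j ≡ (if ⌊ i ≟ j ⌋ then + n else + 0))

IsDiagonal : ∀ {n} → Matrix n → Set
IsDiagonal M = ∀ i j → i ≢ j → M i j ≡ + 0

-- G is Hadamard diagonalizable: some Hadamard H with (1/n) Hᵀ L H diagonal.
-- Since n ≠ 0 whenever there are off-diagonal entries, (1/n)M is diagonal
-- iff M is diagonal, so we state diagonality of Hᵀ L H (integer matrix).
HadamardDiagonalizable : ∀ {n} → Graph n → Set
HadamardDiagonalizable {n} G =
  Σ (Matrix n) λ H → IsHadamard H × IsDiagonal (transpose H ⊗ (laplacian G ⊗ H))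

-- Lexicographic product G₁ ≀ G₂ on Fin (m * n), vertex (u,x) encoded via
-- Data.Fin.combine / remQuot:
-- (u,x) ~ (v,y) iff u ~ v in G₁, or (u = v and x ~ y in G₂).
lexAdj : ∀ {m n} → Graph m → Graph n → Fin (m ℕ.* n) → Fin (m ℕ.* n) → Bool
lexAdj {m} {n} G₁ G₂ a b =
  let (u , x) = remQuot {m} n a
      (v , y) = remQuot {m} n b
  in adj G₁ u v ∨ (⌊ u ≟ v ⌋ ∧ adj G₂ x y)

private
  open import Relation.Binary.PropositionalEquality using (refl; cong₂; sym; cong)
  open import Data.Bool.Properties using (∨-comm)

  ≟-sym : ∀ {k} (u v : Fin k) → ⌊ u ≟ v ⌋ ≡ ⌊ v ≟ u ⌋
  ≟-sym u v with u ≟ v | v ≟ u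
  ... | Relation.Nullary.yes _ | Relation.Nullary.yes _ = refl
  ... | Relation.Nullary.no _  | Relation.Nullary.no _  = refl
  ... | Relation.Nullary.yes p | Relation.Nullary.no q  = Data.Empty.⊥-elim (q (sym p))
    where import Data.Empty
  ... | Relation.Nullary.no q  | Relation.Nullary.yes p = Data.Empty.⊥-elim (q (sym p))
    where import Data.Empty

  ≟-refl : ∀ {k} (u : Fin k) → ⌊ u ≟ u ⌋ ≡ true
  ≟-refl u with u ≟ u
  ... | Relation.Nullary.yes _ = refl
  ... | Relation.Nullary.no q = Data.Empty.⊥-elim (q refl)
    where import Data.Empty

lexProduct : ∀ {m n} → Graph m → Graph n → Graph (m ℕ.* n)
lexProduct {m} {n} G₁ G₂ = record
  { adj = lexAdj G₁ G₂
  ; adj-sym = λ a b → cong₂ _∨_ (adj-sym G₁ _ _)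
                   (cong₂ _∧_ (≟-sym (proj₁ (remQuot {m} n a)) (proj₁ (remQuot {m} n b)))
                              (adj-sym G₂ _ _))
  ; adj-irrefl = λ a → lemma a
  }
  where
  lemma : ∀ a → lexAdj G₁ G₂ a a ≡ false
  lemma a = go (proj₁ (remQuot {m} n a)) (proj₂ (remQuot {m} n a))
    where
    go : ∀ u x → (adj G₁ u u ∨ (⌊ u ≟ u ⌋ ∧ adj G₂ x x)) ≡ false
    go u x rewrite adj-irrefl G₁ u | ≟-refl u | adj-irrefl G₂ x = refl

infixl 7 _≀_
_≀_ : ∀ {m n} → Graph m → Graph n → Graph (m ℕ.* n)
_≀_ = lexProduct

-- A Hadamard diagonalizable graph G on n vertices has a ±1 eigenbasis H of its Laplacian L
-- with HᵀH = HHᵀ = nI, so L = H Λ Hᵀ / n and every L_uu equals ∑ λⱼ / n: G is regular.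
-- The all-ones vector lies in the kernel of L, so some column of H has nonzero sum and
-- eigenvalue 0; being ±1 it is constant on edges, and flipping the rows of H by its signs gives
-- an eigenbasis whose columns are either all ones or sum to zero. For such a basis K of G₂ and
-- any basis H of G₁, the Kronecker product H ⊗ K diagonalizes G₁ ≀ G₂: its Laplacian sends
-- h ⊗ 1 to n (L₁ h) ⊗ 1, and h ⊗ k with ∑ k = 0 to n d₁ (h ⊗ k) + h ⊗ L₂ k, where d₁ is the
-- common degree of G₁.
module Submission where

open import Defs

open import Data.Nat using (ℕ; zero; suc)
import Data.Nat as ℕ
open import Data.Fin using (Fin; zero; suc; _≟_; combine; remQuot; _↑ˡ_; _↑ʳ_)
open import Data.Fin.Properties using (suc-injective; remQuot-combine; combine-remQuot; ¬∀⟶∃¬)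
open import Data.Bool using (Bool; true; false; _∨_; _∧_; if_then_else_)
open import Data.Integer using (ℤ; +_; -_; _+_; _*_; _-_; _≤_; +≤+; -[1+_])
import Data.Integer.Properties as ℤ
open import Data.Integer.Tactic.RingSolver using (solve-∀)
open import Data.Product using (_,_; proj₁; proj₂; Σ; ∃; uncurry)
open import Data.Sum using (_⊎_; inj₁; inj₂; [_,_]′)
open import Data.Empty using (⊥-elim)
open import Function using (_∘_)
open import Relation.Binary.PropositionalEquality
open import Relation.Nullary using (Dec; yes; no; ¬_)
open import Relation.Nullary.Decidable using (⌊_⌋)

open ≡-Reasoning

-- Finite sums

∑-cong : ∀ {n} {f g : Fin n → ℤ} → (∀ i → f i ≡ g i) → ∑ f ≡ ∑ g
∑-cong {zero}  f≗g = refl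
∑-cong {suc n} f≗g = cong₂ _+_ (f≗g zero) (∑-cong (λ i → f≗g (suc i)))

∑-zero : ∀ n → ∑ {n} (λ _ → + 0) ≡ + 0
∑-zero zero    = refl
∑-zero (suc n) = trans (ℤ.+-identityˡ _) (∑-zero n)

∑-const : ∀ n (c : ℤ) → ∑ {n} (λ _ → c) ≡ + n * c
∑-const zero    c = refl
∑-const (suc n) c = begin
  c + ∑ {n} (λ _ → c)   ≡⟨ cong (_+_ c) (∑-const n c) ⟩
  c + + n * c           ≡⟨ cong (_+ + n * c) (ℤ.*-identityˡ c) ⟨
  + 1 * c + + n * c     ≡⟨ ℤ.*-distribʳ-+ c (+ 1) (+ n) ⟨
  + suc n * c           ∎

∑-distrib-+ : ∀ {n} (f g : Fin n → ℤ) → ∑ (λ i → f i + g i) ≡ ∑ f + ∑ g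
∑-distrib-+ {zero}  f g = refl
∑-distrib-+ {suc n} f g = begin
  f zero + g zero + ∑ (λ i → f (suc i) + g (suc i))
    ≡⟨ cong (_+_ (f zero + g zero)) (∑-distrib-+ (λ i → f (suc i)) (λ i → g (suc i))) ⟩
  f zero + g zero + (∑ (λ i → f (suc i)) + ∑ (λ i → g (suc i)))
    ≡⟨ shuffle (f zero) (g zero) _ _ ⟩
  f zero + ∑ (λ i → f (suc i)) + (g zero + ∑ (λ i → g (suc i)))
    ∎
  where
  shuffle : ∀ a b c d → a + b + (c + d) ≡ a + c + (b + d)
  shuffle = solve-∀

∑-neg : ∀ {n} (f : Fin n → ℤ) → ∑ (λ i → - f i) ≡ - ∑ f
∑-neg {zero}  f = refl
∑-neg {suc n} f = trans (cong (_+_ (- f zero)) (∑-neg (λ i → f (suc i))))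
                        (sym (ℤ.neg-distrib-+ (f zero) _))

∑-distrib-- : ∀ {n} (f g : Fin n → ℤ) → ∑ (λ i → f i - g i) ≡ ∑ f - ∑ g
∑-distrib-- f g = trans (∑-distrib-+ f (λ i → - g i)) (cong (_+_ (∑ f)) (∑-neg g))

*-distribˡ-∑ : ∀ {n} (c : ℤ) (f : Fin n → ℤ) → c * ∑ f ≡ ∑ (λ i → c * f i)
*-distribˡ-∑ {zero}  c f = ℤ.*-zeroʳ c
*-distribˡ-∑ {suc n} c f = trans (ℤ.*-distribˡ-+ c (f zero) _)
                                 (cong (_+_ (c * f zero)) (*-distribˡ-∑ c (λ i → f (suc i))))

*-distribʳ-∑ : ∀ {n} (c : ℤ) (f : Fin n → ℤ) → ∑ f * c ≡ ∑ (λ i → f i * c)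
*-distribʳ-∑ c f = trans (ℤ.*-comm (∑ f) c)
                         (trans (*-distribˡ-∑ c f) (∑-cong (λ i → ℤ.*-comm c (f i))))

∑-linear : ∀ {n} (a b : ℤ) (f g : Fin n → ℤ) → ∑ (λ i → a * f i + b * g i) ≡ a * ∑ f + b * ∑ g
∑-linear {n} a b f g = trans (∑-distrib-+ {n} _ _) (sym (cong₂ _+_ (*-distribˡ-∑ a f) (*-distribˡ-∑ b g)))

∑-*-∑ : ∀ {m n} (f : Fin m → ℤ) (g : Fin n → ℤ) → ∑ f * ∑ g ≡ ∑ (λ i → ∑ (λ j → f i * g j))
∑-*-∑ {m} {n} f g = trans (*-distribʳ-∑ {m} (∑ g) f) (∑-cong {m} (λ i → *-distribˡ-∑ {n} (f i) g))

∑-comm : ∀ {m n} (f : Fin m → Fin n → ℤ) →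
         ∑ (λ i → ∑ (λ j → f i j)) ≡ ∑ (λ j → ∑ (λ i → f i j))
∑-comm {zero}  {n} f = sym (∑-zero n)
∑-comm {suc m} {n} f = trans (cong (_+_ (∑ (f zero))) (∑-comm (λ i → f (suc i))))
                             (sym (∑-distrib-+ (f zero) (λ j → ∑ (λ i → f (suc i) j))))

∑-supported : ∀ {n} (f : Fin n → ℤ) i → (∀ j → j ≢ i → f j ≡ + 0) → ∑ f ≡ f i
∑-supported {suc n} f zero vanish = begin
  f zero + ∑ (λ j → f (suc j))   ≡⟨ cong (_+_ (f zero)) (∑-cong (λ j → vanish (suc j) λ ()))  ⟩
  f zero + ∑ {n} (λ _ → + 0)     ≡⟨ cong (_+_ (f zero)) (∑-zero n) ⟩
  f zero + + 0                   ≡⟨ ℤ.+-identityʳ (f zero) ⟩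
  f zero                         ∎
∑-supported {suc n} f (suc i) vanish = begin
  f zero + ∑ (λ j → f (suc j))   ≡⟨ cong (_+ ∑ (λ j → f (suc j))) (vanish zero λ ()) ⟩
  + 0 + ∑ (λ j → f (suc j))      ≡⟨ ℤ.+-identityˡ _ ⟩
  ∑ (λ j → f (suc j))            ≡⟨ ∑-supported (f ∘ suc) i (λ j j≢i → vanish (suc j) (j≢i ∘ suc-injective)) ⟩
  f (suc i)                      ∎

∑-++ : ∀ {a b} (f : Fin (a ℕ.+ b) → ℤ) → ∑ f ≡ ∑ (λ i → f (i ↑ˡ b)) + ∑ (λ j → f (a ↑ʳ j))
∑-++ {zero}      f = sym (ℤ.+-identityˡ _)
∑-++ {suc a} {b} f = trans (cong (_+_ (f zero)) (∑-++ {a} (λ i → f (suc i))))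
                           (sym (ℤ.+-assoc (f zero) _ _))

∑-combine : ∀ {m n} (f : Fin (m ℕ.* n) → ℤ) → ∑ f ≡ ∑ (λ u → ∑ (λ x → f (combine {m} {n} u x)))
∑-combine {zero}      f = refl
∑-combine {suc m} {n} f = trans (∑-++ {n} f)
                                (cong (_+_ (∑ (λ x → f (x ↑ˡ (m ℕ.* n))))) (∑-combine {m} (λ a → f (n ↑ʳ a))))

∑-nonneg : ∀ {n} (f : Fin n → ℤ) → (∀ i → + 0 ≤ f i) → + 0 ≤ ∑ f
∑-nonneg {zero}  f f≥0 = +≤+ ℕ.z≤n
∑-nonneg {suc n} f f≥0 = ℤ.+-mono-≤ (f≥0 zero) (∑-nonneg (λ i → f (suc i)) (λ i → f≥0 (suc i)))

∑-nonneg-≡0 : ∀ {n} (f : Fin n → ℤ) → (∀ i → + 0 ≤ f i) → ∑ f ≡ + 0 → ∀ i → f i ≡ + 0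
∑-nonneg-≡0 {suc n} f f≥0 ∑f≡0 = pointwise
  where
  rest≥0 : + 0 ≤ ∑ (λ i → f (suc i))
  rest≥0 = ∑-nonneg (λ i → f (suc i)) (λ i → f≥0 (suc i))

  head≤∑ : f zero ≤ ∑ f
  head≤∑ = ℤ.≤-trans (ℤ.≤-reflexive (sym (ℤ.+-identityʳ (f zero)))) (ℤ.+-monoʳ-≤ (f zero) rest≥0)

  head≡0 : f zero ≡ + 0
  head≡0 = ℤ.≤-antisym (subst (f zero ≤_) ∑f≡0 head≤∑) (f≥0 zero)

  pointwise : ∀ i → f i ≡ + 0
  pointwise zero    = head≡0
  pointwise (suc i) = ∑-nonneg-≡0 (λ i → f (suc i)) (λ i → f≥0 (suc i))
                        (trans (sym (ℤ.+-identityˡ _)) (trans (cong (_+ ∑ (λ i → f (suc i))) (sym head≡0)) ∑f≡0)) i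

δ : ∀ {n} → Fin n → Fin n → ℤ
δ i j = if ⌊ i ≟ j ⌋ then + 1 else + 0

δ-refl : ∀ {n} (i : Fin n) → δ i i ≡ + 1
δ-refl i with i ≟ i
... | yes _  = refl
... | no i≢i = ⊥-elim (i≢i refl)

δ-≢ : ∀ {n} {i j : Fin n} → i ≢ j → δ i j ≡ + 0
δ-≢ {i = i} {j} i≢j with i ≟ j
... | yes i≡j = ⊥-elim (i≢j i≡j)
... | no _    = refl

δ-idem : ∀ {n} (i j : Fin n) → δ i j * δ i j ≡ δ i j
δ-idem i j with ⌊ i ≟ j ⌋
... | true  = refl
... | false = refl

if-≟ : ∀ {n} (i j : Fin n) (c : ℤ) → (if ⌊ i ≟ j ⌋ then c else + 0) ≡ c * δ i j
if-≟ i j c with ⌊ i ≟ j ⌋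
... | true  = sym (ℤ.*-identityʳ c)
... | false = sym (ℤ.*-zeroʳ c)

∑-δˡ : ∀ {n} (i : Fin n) (f : Fin n → ℤ) → ∑ (λ j → δ i j * f j) ≡ f i
∑-δˡ i f = trans (∑-supported _ i (λ j j≢i → trans (cong (_* f j) (δ-≢ (j≢i ∘ sym))) (ℤ.*-zeroˡ (f j))))
                 (trans (cong (_* f i) (δ-refl i)) (ℤ.*-identityˡ (f i)))

∑-δʳ : ∀ {n} (i : Fin n) (f : Fin n → ℤ) → ∑ (λ j → f j * δ j i) ≡ f i
∑-δʳ i f = trans (∑-supported _ i (λ j j≢i → trans (cong (f j *_) (δ-≢ j≢i)) (ℤ.*-zeroʳ (f j))))
                 (trans (cong (f i *_) (δ-refl i)) (ℤ.*-identityʳ (f i)))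

∑-scaled-δˡ : ∀ {n} (c : ℤ) (x : Fin n) (f : Fin n → ℤ) → ∑ (λ w → c * δ x w * f w) ≡ c * f x
∑-scaled-δˡ {n} c x f = begin
  ∑ (λ w → c * δ x w * f w)     ≡⟨ ∑-cong {n} (λ w → ℤ.*-assoc c (δ x w) (f w)) ⟩
  ∑ (λ w → c * (δ x w * f w))   ≡⟨ *-distribˡ-∑ {n} c _ ⟨
  c * ∑ (λ w → δ x w * f w)     ≡⟨ cong (c *_) (∑-δˡ x f) ⟩
  c * f x                       ∎

∑-scaled-δʳ : ∀ {n} (c : ℤ) (x : Fin n) (f : Fin n → ℤ) → ∑ (λ w → f w * (c * δ w x)) ≡ c * f x
∑-scaled-δʳ {n} c x f = begin
  ∑ (λ w → f w * (c * δ w x))   ≡⟨ ∑-cong {n} (λ w → swap (f w) c (δ w x)) ⟩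
  ∑ (λ w → c * (f w * δ w x))   ≡⟨ *-distribˡ-∑ {n} c _ ⟨
  c * ∑ (λ w → f w * δ w x)     ≡⟨ cong (c *_) (∑-δʳ x f) ⟩
  c * f x                       ∎
  where
  swap : ∀ a b d → a * (b * d) ≡ b * (a * d)
  swap = solve-∀

-- ±1 matrices

IsSign : ℤ → Set
IsSign x = x ≡ + 1 ⊎ x ≡ - + 1

sign-square : ∀ {x} → IsSign x → x * x ≡ + 1
sign-square (inj₁ refl) = refl
sign-square (inj₂ refl) = refl

sign-* : ∀ {x y} → IsSign x → IsSign y → IsSign (x * y)
sign-* (inj₁ refl) (inj₁ refl) = inj₁ refl
sign-* (inj₁ refl) (inj₂ refl) = inj₂ refl
sign-* (inj₂ refl) (inj₁ refl) = inj₂ refl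
sign-* (inj₂ refl) (inj₂ refl) = inj₁ refl

sign-gap : ∀ {s t} → IsSign s → IsSign t → + 0 ≤ + 1 - s * t
sign-gap (inj₁ refl) (inj₁ refl) = +≤+ ℕ.z≤n
sign-gap (inj₁ refl) (inj₂ refl) = +≤+ ℕ.z≤n
sign-gap (inj₂ refl) (inj₁ refl) = +≤+ ℕ.z≤n
sign-gap (inj₂ refl) (inj₂ refl) = +≤+ ℕ.z≤n

sign-gap-≡0 : ∀ {s t} → IsSign s → IsSign t → + 1 - s * t ≡ + 0 → s ≡ t
sign-gap-≡0 (inj₁ refl) (inj₁ refl) _  = refl
sign-gap-≡0 (inj₁ refl) (inj₂ refl) ()
sign-gap-≡0 (inj₂ refl) (inj₁ refl) ()
sign-gap-≡0 (inj₂ refl) (inj₂ refl) _  = refl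

square-nonneg : ∀ x → + 0 ≤ x * x
square-nonneg (+ k)    = subst (+ 0 ≤_) (ℤ.pos-* k k) (+≤+ ℕ.z≤n)
square-nonneg -[1+ k ] = +≤+ ℕ.z≤n

square-≡0 : ∀ x → x * x ≡ + 0 → x ≡ + 0
square-≡0 x x²≡0 with ℤ.i*j≡0⇒i≡0∨j≡0 x x²≡0
... | inj₁ x≡0 = x≡0
... | inj₂ x≡0 = x≡0

*-cancelˡ-inhabited : ∀ {n} → Fin n → ∀ a b → + n * a ≡ + n * b → a ≡ b
*-cancelˡ-inhabited {suc n} _ a b = ℤ.*-cancelˡ-≡ (+ suc n) a b

_*ᵥ_ : ∀ {n} → Matrix n → (Fin n → ℤ) → Fin n → ℤ
(M *ᵥ f) i = ∑ (λ k → M i k * f k)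

column : ∀ {n} → Matrix n → Fin n → Fin n → ℤ
column M j i = M i j

⊗-assoc : ∀ {n} (A B C : Matrix n) i j → ((A ⊗ B) ⊗ C) i j ≡ (A ⊗ (B ⊗ C)) i j
⊗-assoc {n} A B C i j = begin
  ∑ (λ k → ∑ (λ l → A i l * B l k) * C k j)
    ≡⟨ ∑-cong {n} (λ k → *-distribʳ-∑ {n} (C k j) _) ⟩
  ∑ (λ k → ∑ (λ l → A i l * B l k * C k j))
    ≡⟨ ∑-comm {n} {n} _ ⟩
  ∑ (λ l → ∑ (λ k → A i l * B l k * C k j))
    ≡⟨ ∑-cong {n} (λ l → ∑-cong {n} (λ k → ℤ.*-assoc (A i l) _ _)) ⟩
  ∑ (λ l → ∑ (λ k → A i l * (B l k * C k j)))
    ≡⟨ ∑-cong {n} (λ l → *-distribˡ-∑ {n} (A i l) _) ⟨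
  ∑ (λ l → A i l * ∑ (λ k → B l k * C k j))
    ∎

frobenius : ∀ {n} → Matrix n → ℤ
frobenius M = ∑ (λ a → ∑ (λ b → M a b * M a b))

frobenius-⊗-transpose : ∀ {n} (H : Matrix n) →
                        frobenius (H ⊗ transpose H) ≡ frobenius (transpose H ⊗ H)
frobenius-⊗-transpose {n} H = begin
  ∑ (λ a → ∑ (λ b → ∑ (λ i → H a i * H b i) * ∑ (λ j → H a j * H b j)))
    ≡⟨ ∑-cong {n} (λ a → ∑-cong {n} (λ b → ∑-*-∑ {n} {n} _ _)) ⟩
  ∑ (λ a → ∑ (λ b → ∑ (λ i → ∑ (λ j → H a i * H b i * (H a j * H b j)))))
    ≡⟨ ∑-cong {n} (λ a → trans (∑-comm {n} {n} _) (∑-cong {n} (λ i → ∑-comm {n} {n} _))) ⟩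
  ∑ (λ a → ∑ (λ i → ∑ (λ j → ∑ (λ b → H a i * H b i * (H a j * H b j)))))
    ≡⟨ trans (∑-comm {n} {n} _) (∑-cong {n} (λ i → ∑-comm {n} {n} _)) ⟩
  ∑ (λ i → ∑ (λ j → ∑ (λ a → ∑ (λ b → H a i * H b i * (H a j * H b j)))))
    ≡⟨ ∑-cong {n} (λ i → ∑-cong {n} (λ j → ∑-cong {n} (λ a → ∑-cong {n} (λ b →
         regroup (H a i) (H b i) (H a j) (H b j))))) ⟩
  ∑ (λ i → ∑ (λ j → ∑ (λ a → ∑ (λ b → H a i * H a j * (H b i * H b j)))))
    ≡⟨ ∑-cong {n} (λ i → ∑-cong {n} (λ j → ∑-*-∑ {n} {n} _ _)) ⟨
  ∑ (λ i → ∑ (λ j → ∑ (λ a → H a i * H a j) * ∑ (λ b → H b i * H b j)))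
    ∎
  where
  regroup : ∀ a b c d → a * b * (c * d) ≡ a * c * (b * d)
  regroup = solve-∀

frobenius-scaled-δ : ∀ n (c : ℤ) → frobenius {n} (λ i j → c * δ i j) ≡ + n * (c * c)
frobenius-scaled-δ n c = begin
  ∑ {n} (λ i → ∑ (λ j → c * δ i j * (c * δ i j)))   ≡⟨ ∑-cong {n} (λ i → ∑-cong (λ j → square i j)) ⟩
  ∑ {n} (λ i → ∑ (λ j → δ i j * (c * c)))           ≡⟨ ∑-cong {n} (λ i → ∑-δˡ i (λ _ → c * c)) ⟩
  ∑ {n} (λ _ → c * c)                               ≡⟨ ∑-const n (c * c) ⟩
  + n * (c * c)                                     ∎
  where
  regroup : ∀ c d → c * d * (c * d) ≡ d * d * (c * c)
  regroup = solve-∀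
  square : ∀ i j → c * δ i j * (c * δ i j) ≡ δ i j * (c * c)
  square i j = trans (regroup c (δ i j)) (cong (_* (c * c)) (δ-idem i j))

-- HHᵀ has diagonal entries n and the same Frobenius norm n³ as HᵀH = nI, so its
-- off-diagonal entries have square sum 0.
rows-orthogonal : ∀ {n} (H : Matrix n) → (∀ i j → IsSign (H i j)) →
                  (∀ i j → (transpose H ⊗ H) i j ≡ + n * δ i j) →
                  ∀ a b → (H ⊗ transpose H) a b ≡ + n * δ a b
rows-orthogonal {n} H sign cols = rows
  where
  P = H ⊗ transpose H
  n² = + n * + n

  P-diag : ∀ a → P a a ≡ + n
  P-diag a = trans (∑-cong (λ j → sign-square (sign a j))) (trans (∑-const n (+ 1)) (ℤ.*-identityʳ (+ n)))

  excess : Fin n → Fin n → ℤ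
  excess a b = P a b * P a b - δ a b * n²

  excess-nonneg : ∀ a b → + 0 ≤ excess a b
  excess-nonneg a b = by-cases (a ≟ b)
    where
    by-cases : Dec (a ≡ b) → + 0 ≤ excess a b
    by-cases (yes refl) = ℤ.≤-reflexive (sym (begin
      P a a * P a a - δ a a * n²   ≡⟨ cong₂ (λ p d → p * p - d * n²) (P-diag a) (δ-refl a) ⟩
      n² - + 1 * n²                ≡⟨ cong (_-_ n²) (ℤ.*-identityˡ n²) ⟩
      n² - n²                      ≡⟨ ℤ.+-inverseʳ n² ⟩
      + 0                          ∎))
    by-cases (no a≢b) = subst (+ 0 ≤_) (sym (begin
      P a b * P a b - δ a b * n²   ≡⟨ cong (λ d → P a b * P a b - d * n²) (δ-≢ a≢b) ⟩
      P a b * P a b - + 0          ≡⟨ ℤ.+-identityʳ _ ⟩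
      P a b * P a b                ∎)) (square-nonneg (P a b))

  excess-sum : ∑ (λ a → ∑ (λ b → excess a b)) ≡ + 0
  excess-sum = begin
    ∑ (λ a → ∑ (λ b → P a b * P a b - δ a b * n²))
      ≡⟨ ∑-cong {n} (λ a → ∑-distrib-- {n} _ _) ⟩
    ∑ (λ a → ∑ (λ b → P a b * P a b) - ∑ (λ b → δ a b * n²))
      ≡⟨ ∑-distrib-- {n} _ _ ⟩
    frobenius P - ∑ {n} (λ a → ∑ (λ b → δ a b * n²))
      ≡⟨ cong₂ _-_ (frobenius-⊗-transpose H) (∑-cong {n} (λ a → ∑-δˡ a (λ _ → n²))) ⟩
    frobenius (transpose H ⊗ H) - ∑ {n} (λ _ → n²)
      ≡⟨ cong₂ _-_ (∑-cong {n} λ i → ∑-cong {n} λ j → cong₂ _*_ (cols i j) (cols i j)) (∑-const n n²) ⟩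
    frobenius {n} (λ i j → + n * δ i j) - + n * n²
      ≡⟨ cong (_- + n * n²) (frobenius-scaled-δ n (+ n)) ⟩
    + n * n² - + n * n²
      ≡⟨ ℤ.+-inverseʳ (+ n * n²) ⟩
    + 0 ∎

  excess-≡0 : ∀ a b → excess a b ≡ + 0
  excess-≡0 a = ∑-nonneg-≡0 _ (excess-nonneg a)
                  (∑-nonneg-≡0 _ (λ a → ∑-nonneg _ (excess-nonneg a)) excess-sum a)

  rows : ∀ a b → P a b ≡ + n * δ a b
  rows a b with a ≟ b
  ... | yes refl = trans (P-diag a) (sym (ℤ.*-identityʳ (+ n)))
  ... | no a≢b   = trans (square-≡0 (P a b) P²≡0) (sym (ℤ.*-zeroʳ (+ n)))
    where
    P²≡0 : P a b * P a b ≡ + 0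
    P²≡0 = trans (sym (trans (cong (λ d → P a b * P a b - d * n²) (δ-≢ a≢b)) (ℤ.+-identityʳ _))) (excess-≡0 a b)

-- Laplacians

adjacency : ∀ {n} → Graph n → Matrix n
adjacency G u v = if adj G u v then + 1 else + 0

deg : ∀ {n} → Graph n → Fin n → ℤ
deg G u = ∑ (adjacency G u)

-- `degree` counts through a function local to its definition; the star graph whose
-- centre is joined exactly to the leaves selected by f exposes that function at f.
star : ∀ {k} → (Fin k → Bool) → Graph (suc k)
star {k} f = record { adj = edge ; adj-sym = edge-sym ; adj-irrefl = edge-irrefl }
  where
  edge : Fin (suc k) → Fin (suc k) → Bool
  edge zero    zero    = false
  edge zero    (suc j) = f j
  edge (suc i) zero    = f i
  edge (suc i) (suc j) = false

  edge-sym : ∀ u v → edge u v ≡ edge v u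
  edge-sym zero    zero    = refl
  edge-sym zero    (suc j) = refl
  edge-sym (suc i) zero    = refl
  edge-sym (suc i) (suc j) = refl

  edge-irrefl : ∀ u → edge u u ≡ false
  edge-irrefl zero    = refl
  edge-irrefl (suc i) = refl

pos-count : ∀ b m → + ((if b then 1 else 0) ℕ.+ m) ≡ (if b then + 1 else + 0) + + m
pos-count true  m = refl
pos-count false m = refl

degree-star : ∀ k (f : Fin k → Bool) → + degree (star f) zero ≡ ∑ (λ i → if f i then + 1 else + 0)
degree-star zero    f = refl
degree-star (suc k) f = trans (pos-count (f zero) _)
                              (cong (_+_ (if f zero then + 1 else + 0)) (degree-star k (λ i → f (suc i))))

degree≡deg : ∀ {n} (G : Graph n) u → + degree G u ≡ deg G u
degree≡deg {suc k} G u = trans (pos-count (adj G u zero) _)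
                               (cong (_+_ (adjacency G u zero)) (degree-star k (λ i → adj G u (suc i))))

adjacency-sym : ∀ {n} (G : Graph n) u v → adjacency G u v ≡ adjacency G v u
adjacency-sym G u v = cong (if_then + 1 else + 0) (adj-sym G u v)

laplacian-entry : ∀ {n} (G : Graph n) u v → laplacian G u v ≡ δ u v * deg G u - adjacency G u v
laplacian-entry G u v with u ≟ v
... | yes refl rewrite adj-irrefl G u = trans (degree≡deg G u) (sym (trans (ℤ.+-identityʳ _) (ℤ.*-identityˡ _)))
... | no _ with adj G u v
...   | true  = refl
...   | false = refl

laplacian-diag : ∀ {n} (G : Graph n) u → laplacian G u u ≡ deg G u
laplacian-diag G u with u ≟ u
... | yes _  = degree≡deg G u
... | no u≢u = ⊥-elim (u≢u refl)

laplacian-sym : ∀ {n} (G : Graph n) u v → laplacian G u v ≡ laplacian G v u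
laplacian-sym G u v = begin
  laplacian G u v                        ≡⟨ laplacian-entry G u v ⟩
  δ u v * deg G u - adjacency G u v      ≡⟨ cong₂ _-_ (diagonal (u ≟ v)) (adjacency-sym G u v) ⟩
  δ v u * deg G v - adjacency G v u      ≡⟨ laplacian-entry G v u ⟨
  laplacian G v u                        ∎
  where
  diagonal : Dec (u ≡ v) → δ u v * deg G u ≡ δ v u * deg G v
  diagonal (yes refl) = refl
  diagonal (no u≢v)   = trans (cong (_* deg G u) (δ-≢ u≢v)) (cong (_* deg G v) (sym (δ-≢ (u≢v ∘ sym))))

laplacian-*ᵥ : ∀ {n} (G : Graph n) (f : Fin n → ℤ) x →
               (laplacian G *ᵥ f) x ≡ deg G x * f x - (adjacency G *ᵥ f) x
laplacian-*ᵥ {n} G f x = begin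
  ∑ (λ w → laplacian G x w * f w)
    ≡⟨ ∑-cong {n} (λ w → trans (cong (_* f w) (laplacian-entry G x w)) (expand (δ x w) (deg G x) _ (f w))) ⟩
  ∑ (λ w → deg G x * (δ x w * f w) - adjacency G x w * f w)
    ≡⟨ ∑-distrib-- {n} _ _ ⟩
  ∑ (λ w → deg G x * (δ x w * f w)) - (adjacency G *ᵥ f) x
    ≡⟨ cong (_- (adjacency G *ᵥ f) x) (trans (sym (*-distribˡ-∑ {n} (deg G x) _)) (cong (deg G x *_) (∑-δˡ x f))) ⟩
  deg G x * f x - (adjacency G *ᵥ f) x
    ∎
  where
  expand : ∀ d D a y → (d * D - a) * y ≡ D * (d * y) - a * y
  expand = solve-∀

adjacency-*ᵥ-ones : ∀ {n} (G : Graph n) x → (adjacency G *ᵥ (λ _ → + 1)) x ≡ deg G x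
adjacency-*ᵥ-ones G x = ∑-cong (λ w → ℤ.*-identityʳ (adjacency G x w))

laplacian-*ᵥ-ones : ∀ {n} (G : Graph n) x → (laplacian G *ᵥ (λ _ → + 1)) x ≡ + 0
laplacian-*ᵥ-ones G x = begin
  (laplacian G *ᵥ (λ _ → + 1)) x          ≡⟨ laplacian-*ᵥ G _ x ⟩
  deg G x * + 1 - (adjacency G *ᵥ (λ _ → + 1)) x
                                         ≡⟨ cong₂ _-_ (ℤ.*-identityʳ (deg G x)) (adjacency-*ᵥ-ones G x) ⟩
  deg G x - deg G x                      ≡⟨ ℤ.+-inverseʳ (deg G x) ⟩
  + 0                                    ∎

∑-laplacian-*ᵥ : ∀ {n} (G : Graph n) (f : Fin n → ℤ) → ∑ (laplacian G *ᵥ f) ≡ + 0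
∑-laplacian-*ᵥ {n} G f = begin
  ∑ (λ x → ∑ (λ w → laplacian G x w * f w))
    ≡⟨ ∑-comm {n} {n} _ ⟩
  ∑ (λ w → ∑ (λ x → laplacian G x w * f w))
    ≡⟨ ∑-cong {n} (λ w → ∑-cong (λ x → cong₂ _*_ (trans (laplacian-sym G x w) (sym (ℤ.*-identityʳ _))) refl)) ⟩
  ∑ (λ w → ∑ (λ x → laplacian G w x * + 1 * f w))
    ≡⟨ ∑-cong {n} (λ w → *-distribʳ-∑ {n} (f w) _) ⟨
  ∑ (λ w → (laplacian G *ᵥ (λ _ → + 1)) w * f w)
    ≡⟨ ∑-cong (λ w → cong (_* f w) (laplacian-*ᵥ-ones G w)) ⟩
  ∑ {n} (λ _ → + 0)
    ≡⟨ ∑-zero n ⟩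
  + 0 ∎

LocallyConstant : ∀ {n} → Graph n → (Fin n → ℤ) → Set
LocallyConstant G f = ∀ x w → adj G x w ≡ true → f x ≡ f w

-- fₓ (L f)ₓ is the sum over w of Aₓ_w (1 - fₓ f_w), whose terms are all nonnegative.
kernel-sign⇒locallyConstant : ∀ {n} (G : Graph n) (f : Fin n → ℤ) → (∀ x → IsSign (f x)) →
                              (∀ x → (laplacian G *ᵥ f) x ≡ + 0) → LocallyConstant G f
kernel-sign⇒locallyConstant {n} G f sign Lf≡0 x w x~w =
  sign-gap-≡0 (sign x) (sign w)
    (trans (sym (ℤ.*-identityˡ _))
           (subst (λ b → (if b then + 1 else + 0) * (+ 1 - f x * f w) ≡ + 0) x~w (gap-≡0 w)))
  where
  gap : Fin n → ℤ
  gap v = adjacency G x v * (+ 1 - f x * f v)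

  gap-nonneg : ∀ v → + 0 ≤ gap v
  gap-nonneg v with adj G x v
  ... | true  = subst (+ 0 ≤_) (sym (ℤ.*-identityˡ _)) (sign-gap (sign x) (sign v))
  ... | false = +≤+ ℕ.z≤n

  ∑gap≡0 : ∑ gap ≡ + 0
  ∑gap≡0 = begin
    ∑ (λ v → adjacency G x v * (+ 1 - f x * f v))
      ≡⟨ ∑-cong {n} (λ v → expand (adjacency G x v) (f x) (f v)) ⟩
    ∑ (λ v → adjacency G x v - f x * (adjacency G x v * f v))
      ≡⟨ ∑-distrib-- {n} _ _ ⟩
    deg G x - ∑ (λ v → f x * (adjacency G x v * f v))
      ≡⟨ cong (_-_ (deg G x)) (*-distribˡ-∑ {n} (f x) _) ⟨
    deg G x - f x * (adjacency G *ᵥ f) x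
      ≡⟨ cong (_- f x * (adjacency G *ᵥ f) x)
              (trans (sym (ℤ.*-identityʳ (deg G x))) (cong (deg G x *_) (sym (sign-square (sign x))))) ⟩
    deg G x * (f x * f x) - f x * (adjacency G *ᵥ f) x
      ≡⟨ factor (deg G x) (f x) _ ⟩
    f x * (deg G x * f x - (adjacency G *ᵥ f) x)
      ≡⟨ cong (f x *_) (trans (sym (laplacian-*ᵥ G f x)) (Lf≡0 x)) ⟩
    f x * + 0
      ≡⟨ ℤ.*-zeroʳ (f x) ⟩
    + 0 ∎
    where
    expand : ∀ a s t → a * (+ 1 - s * t) ≡ a - s * (a * t)
    expand = solve-∀
    factor : ∀ d s y → d * (s * s) - s * y ≡ s * (d * s - y)
    factor = solve-∀

  gap-≡0 : ∀ v → gap v ≡ + 0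
  gap-≡0 = ∑-nonneg-≡0 gap gap-nonneg ∑gap≡0

adjacency-flip : ∀ {n} (G : Graph n) {σ : Fin n → ℤ} → LocallyConstant G σ →
                 ∀ x w → adjacency G x w * σ w ≡ σ x * adjacency G x w
adjacency-flip G {σ} lc x w with adj G x w in x~w
... | true  = trans (ℤ.*-identityˡ (σ w)) (trans (sym (lc x w x~w)) (sym (ℤ.*-identityʳ (σ x))))
... | false = sym (ℤ.*-zeroʳ (σ x))

laplacian-flip : ∀ {n} (G : Graph n) {σ : Fin n → ℤ} → LocallyConstant G σ →
                 ∀ x w → laplacian G x w * σ w ≡ σ x * laplacian G x w
laplacian-flip G {σ} lc x w = begin
  laplacian G x w * σ w                             ≡⟨ cong (_* σ w) (laplacian-entry G x w) ⟩
  (δ x w * deg G x - adjacency G x w) * σ w         ≡⟨ expand (δ x w) (deg G x) (adjacency G x w) (σ w) ⟩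
  deg G x * (δ x w * σ w) - adjacency G x w * σ w
                                                    ≡⟨ cong₂ (λ s t → deg G x * s - t) (diagonal (x ≟ w)) (adjacency-flip G lc x w) ⟩
  deg G x * (δ x w * σ x) - σ x * adjacency G x w   ≡⟨ collect (δ x w) (deg G x) (adjacency G x w) (σ x) ⟩
  σ x * (δ x w * deg G x - adjacency G x w)         ≡⟨ cong (σ x *_) (laplacian-entry G x w) ⟨
  σ x * laplacian G x w                             ∎
  where
  expand : ∀ d D a s → (d * D - a) * s ≡ D * (d * s) - a * s
  expand = solve-∀
  collect : ∀ d D a s → D * (d * s) - s * a ≡ s * (d * D - a)
  collect = solve-∀
  diagonal : Dec (x ≡ w) → δ x w * σ w ≡ δ x w * σ x
  diagonal (yes refl) = refl
  diagonal (no x≢w)   = trans (cong (_* σ w) (δ-≢ x≢w)) (cong (_* σ x) (sym (δ-≢ x≢w)))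

-- Hadamard eigenbases

-- The eigenvalue field is n times the eigenvalue of the column: n L H = H diag(eigenvalue)
-- keeps the eigen-equation inside ℤ.
record HadamardEigenbasis {n} (G : Graph n) : Set where
  field
    matrix             : Matrix n
    eigenvalue         : Fin n → ℤ
    entries-sign       : ∀ i j → IsSign (matrix i j)
    columns-orthogonal : ∀ i j → (transpose matrix ⊗ matrix) i j ≡ + n * δ i j
    eigenvector        : ∀ x j → + n * (laplacian G ⊗ matrix) x j ≡ eigenvalue j * matrix x j

diagonalizable⇒eigenbasis : ∀ {n} {G : Graph n} → HadamardDiagonalizable G → HadamardEigenbasis G
diagonalizable⇒eigenbasis {n} {G} (H , (sign , orthogonal) , diagonal) = record
  { matrix             = H
  ; eigenvalue         = λ j → M j j
  ; entries-sign       = sign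
  ; columns-orthogonal = columns
  ; eigenvector        = eigen
  }
  where
  L = laplacian G
  M = transpose H ⊗ (L ⊗ H)

  columns : ∀ i j → (transpose H ⊗ H) i j ≡ + n * δ i j
  columns i j = trans (orthogonal i j) (if-≟ i j (+ n))

  eigen : ∀ x j → + n * (L ⊗ H) x j ≡ M j j * H x j
  eigen x j = begin
    + n * (L ⊗ H) x j
      ≡⟨ ∑-scaled-δˡ (+ n) x (λ w → (L ⊗ H) w j) ⟨
    ∑ (λ w → + n * δ x w * (L ⊗ H) w j)
      ≡⟨ ∑-cong {n} (λ w → cong (_* (L ⊗ H) w j) (rows-orthogonal H sign columns x w)) ⟨
    ((H ⊗ transpose H) ⊗ (L ⊗ H)) x j
      ≡⟨ ⊗-assoc H (transpose H) (L ⊗ H) x j ⟩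
    ∑ (λ i → H x i * M i j)
      ≡⟨ ∑-supported _ j (λ i i≢j → trans (cong (H x i *_) (diagonal i j i≢j)) (ℤ.*-zeroʳ (H x i))) ⟩
    H x j * M j j
      ≡⟨ ℤ.*-comm (H x j) (M j j) ⟩
    M j j * H x j
      ∎

module _ {n} {G : Graph n} (E : HadamardEigenbasis G) where
  open HadamardEigenbasis E renaming (matrix to H)

  private
    L = laplacian G

    rows : ∀ a b → (H ⊗ transpose H) a b ≡ + n * δ a b
    rows = rows-orthogonal H entries-sign columns-orthogonal

  scaled-spectral : ∀ i j → + n * (transpose H ⊗ (L ⊗ H)) i j ≡ eigenvalue j * (+ n * δ i j)
  scaled-spectral i j = begin
    + n * ∑ (λ x → H x i * (L ⊗ H) x j)        ≡⟨ *-distribˡ-∑ {n} (+ n) _ ⟩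
    ∑ (λ x → + n * (H x i * (L ⊗ H) x j))      ≡⟨ ∑-cong {n} (λ x → trans (swap (+ n) (H x i) _)
                                                                         (cong (H x i *_) (eigenvector x j))) ⟩
    ∑ (λ x → H x i * (eigenvalue j * H x j))   ≡⟨ ∑-cong {n} (λ x → swap (H x i) (eigenvalue j) (H x j)) ⟩
    ∑ (λ x → eigenvalue j * (H x i * H x j))   ≡⟨ *-distribˡ-∑ {n} (eigenvalue j) _ ⟨
    eigenvalue j * (transpose H ⊗ H) i j      ≡⟨ cong (eigenvalue j *_) (columns-orthogonal i j) ⟩
    eigenvalue j * (+ n * δ i j)              ∎
    where
    swap : ∀ a b c → a * (b * c) ≡ b * (a * c)
    swap = solve-∀

  eigenbasis⇒diagonalizable : HadamardDiagonalizable G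
  eigenbasis⇒diagonalizable =
    H , (entries-sign , λ i j → trans (columns-orthogonal i j) (sym (if-≟ i j (+ n)))) , diagonal
    where
    diagonal : IsDiagonal (transpose H ⊗ (L ⊗ H))
    diagonal i j i≢j = *-cancelˡ-inhabited i _ _ (begin
      + n * (transpose H ⊗ (L ⊗ H)) i j   ≡⟨ scaled-spectral i j ⟩
      eigenvalue j * (+ n * δ i j)        ≡⟨ cong (λ d → eigenvalue j * (+ n * d)) (δ-≢ i≢j) ⟩
      eigenvalue j * (+ n * + 0)          ≡⟨ cong (eigenvalue j *_) (ℤ.*-zeroʳ (+ n)) ⟩
      eigenvalue j * + 0                  ≡⟨ ℤ.*-zeroʳ (eigenvalue j) ⟩
      + 0                                 ≡⟨ ℤ.*-zeroʳ (+ n) ⟨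
      + n * + 0                           ∎)

  scaled-degree : ∀ u → + n * (+ n * deg G u) ≡ ∑ eigenvalue
  scaled-degree u = begin
    + n * (+ n * deg G u)
      ≡⟨ cong (λ d → + n * (+ n * d)) (laplacian-diag G u) ⟨
    + n * (+ n * L u u)
      ≡⟨ cong (+ n *_) (trans (sym (∑-scaled-δʳ (+ n) u (L u)))
           (∑-cong {n} (λ w → cong (L u w *_) (sym (rows w u))))) ⟩
    + n * (L ⊗ (H ⊗ transpose H)) u u
      ≡⟨ cong (+ n *_) (⊗-assoc L H (transpose H) u u) ⟨
    + n * ∑ (λ j → (L ⊗ H) u j * H u j)
      ≡⟨ *-distribˡ-∑ {n} (+ n) _ ⟩
    ∑ (λ j → + n * ((L ⊗ H) u j * H u j))
      ≡⟨ ∑-cong {n} (λ j → trans (sym (ℤ.*-assoc (+ n) _ (H u j))) (cong (_* H u j) (eigenvector u j))) ⟩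
    ∑ (λ j → eigenvalue j * H u j * H u j)
      ≡⟨ ∑-cong {n} (λ j → trans (ℤ.*-assoc (eigenvalue j) _ _)
                            (trans (cong (eigenvalue j *_) (sign-square (entries-sign u j))) (ℤ.*-identityʳ _))) ⟩
    ∑ eigenvalue ∎

  regular : ∀ u v → deg G u ≡ deg G v
  regular u v = *-cancelˡ-inhabited u _ _
                  (*-cancelˡ-inhabited u _ _ (trans (scaled-degree u) (sym (scaled-degree v))))

  eigenvalue-*-column-sum : ∀ j → eigenvalue j * ∑ (column H j) ≡ + 0
  eigenvalue-*-column-sum j = begin
    eigenvalue j * ∑ (column H j)          ≡⟨ *-distribˡ-∑ {n} (eigenvalue j) _ ⟩
    ∑ (λ x → eigenvalue j * H x j)         ≡⟨ ∑-cong {n} (λ x → eigenvector x j) ⟨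
    ∑ (λ x → + n * (L ⊗ H) x j)            ≡⟨ *-distribˡ-∑ {n} (+ n) _ ⟨
    + n * ∑ (L *ᵥ column H j)              ≡⟨ cong (+ n *_) (∑-laplacian-*ᵥ G (column H j)) ⟩
    + n * + 0                              ≡⟨ ℤ.*-zeroʳ (+ n) ⟩
    + 0                                    ∎

  column-in-kernel : ∀ j → ∑ (column H j) ≢ + 0 → ∀ x → (L *ᵥ column H j) x ≡ + 0
  column-in-kernel j sum≢0 x with ℤ.i*j≡0⇒i≡0∨j≡0 (eigenvalue j) (eigenvalue-*-column-sum j)
  ... | inj₂ sum≡0 = ⊥-elim (sum≢0 sum≡0)
  ... | inj₁ eigenvalue≡0 = *-cancelˡ-inhabited x _ _ (begin
    + n * (L ⊗ H) x j           ≡⟨ eigenvector x j ⟩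
    eigenvalue j * H x j        ≡⟨ cong (_* H x j) eigenvalue≡0 ⟩
    + 0                         ≡⟨ ℤ.*-zeroʳ (+ n) ⟨
    + n * + 0                   ∎)

  -- Summing row x of H Hᵀ = n I gives ∑ⱼ Hₓⱼ (column sum j) = n ≠ 0.
  column-sum-nonzero : Fin n → ∃ λ j → ∑ (column H j) ≢ + 0
  column-sum-nonzero x = ¬∀⟶∃¬ n _ (λ j → ∑ (column H j) ℤ.≟ + 0) all-zero⇒⊥
    where
    all-zero⇒⊥ : ¬ (∀ j → ∑ (column H j) ≡ + 0)
    all-zero⇒⊥ sums≡0 with () ← *-cancelˡ-inhabited x (+ 1) (+ 0) (begin
      + n * + 1                                        ≡⟨ ∑-scaled-δˡ (+ n) x (λ _ → + 1) ⟨
      ∑ (λ w → + n * δ x w * + 1)                      ≡⟨ ∑-cong {n} (λ w → trans (ℤ.*-identityʳ _) (sym (rows x w))) ⟩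
      ∑ (λ w → ∑ (λ j → H x j * H w j))                ≡⟨ ∑-comm {n} {n} _ ⟩
      ∑ (λ j → ∑ (λ w → H x j * H w j))                ≡⟨ ∑-cong {n} (λ j → trans (sym (*-distribˡ-∑ {n} (H x j) _))
                                                                                (cong (H x j *_) (sums≡0 j))) ⟩
      ∑ (λ j → H x j * + 0)                            ≡⟨ ∑-cong {n} (λ j → ℤ.*-zeroʳ (H x j)) ⟩
      ∑ {n} (λ _ → + 0)                                ≡⟨ ∑-zero n ⟩
      + 0                                              ≡⟨ ℤ.*-zeroʳ (+ n) ⟨
      + n * + 0                                        ∎)

  flip-rows : (σ : Fin n → ℤ) → (∀ x → IsSign (σ x)) → LocallyConstant G σ → HadamardEigenbasis G
  flip-rows σ σ-sign σ-constant = record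
    { matrix             = K
    ; eigenvalue         = eigenvalue
    ; entries-sign       = λ x j → sign-* (σ-sign x) (entries-sign x j)
    ; columns-orthogonal = λ i j → trans (∑-cong {n} (λ x → unflip x i j)) (columns-orthogonal i j)
    ; eigenvector        = eigen
    }
    where
    K : Matrix n
    K x j = σ x * H x j

    unflip : ∀ x i j → K x i * K x j ≡ H x i * H x j
    unflip x i j = begin
      σ x * H x i * (σ x * H x j)     ≡⟨ regroup (σ x) (H x i) (H x j) ⟩
      σ x * σ x * (H x i * H x j)     ≡⟨ cong (_* (H x i * H x j)) (sign-square (σ-sign x)) ⟩
      + 1 * (H x i * H x j)           ≡⟨ ℤ.*-identityˡ _ ⟩
      H x i * H x j                   ∎
      where
      regroup : ∀ s a b → s * a * (s * b) ≡ s * s * (a * b)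
      regroup = solve-∀

    eigen : ∀ x j → + n * (L ⊗ K) x j ≡ eigenvalue j * K x j
    eigen x j = begin
      + n * ∑ (λ w → L x w * (σ w * H w j))     ≡⟨ cong (+ n *_) (∑-cong {n} (λ w → move-sign w)) ⟩
      + n * ∑ (λ w → σ x * (L x w * H w j))     ≡⟨ cong (+ n *_) (*-distribˡ-∑ {n} (σ x) _) ⟨
      + n * (σ x * (L ⊗ H) x j)                 ≡⟨ swap (+ n) (σ x) _ ⟩
      σ x * (+ n * (L ⊗ H) x j)                 ≡⟨ cong (σ x *_) (eigenvector x j) ⟩
      σ x * (eigenvalue j * H x j)              ≡⟨ swap (σ x) (eigenvalue j) (H x j) ⟩
      eigenvalue j * K x j                      ∎
      where
      swap : ∀ a b c → a * (b * c) ≡ b * (a * c)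
      swap = solve-∀
      move-sign : ∀ w → L x w * (σ w * H w j) ≡ σ x * (L x w * H w j)
      move-sign w = begin
        L x w * (σ w * H w j)   ≡⟨ ℤ.*-assoc (L x w) (σ w) (H w j) ⟨
        L x w * σ w * H w j     ≡⟨ cong (_* H w j) (laplacian-flip G σ-constant x w) ⟩
        σ x * L x w * H w j     ≡⟨ ℤ.*-assoc (σ x) (L x w) (H w j) ⟩
        σ x * (L x w * H w j)   ∎

OnesOrZeroSum : ∀ {n} → Matrix n → Set
OnesOrZeroSum K = ∀ y → (∀ x → K x y ≡ + 1) ⊎ ∑ (column K y) ≡ + 0

NormalizedEigenbasis : ∀ {n} → Graph n → Set
NormalizedEigenbasis G = Σ (HadamardEigenbasis G) (λ E → OnesOrZeroSum (HadamardEigenbasis.matrix E))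

normalize-by-column : ∀ {n} {G : Graph n} (E : HadamardEigenbasis G) z →
                      ∑ (column (HadamardEigenbasis.matrix E) z) ≢ + 0 → NormalizedEigenbasis G
normalize-by-column {n} {G} E z sum≢0 = K-basis , ones-or-zero-sum
  where
  open HadamardEigenbasis E renaming (matrix to H)

  σ : Fin n → ℤ
  σ = column H z

  K-basis : HadamardEigenbasis G
  K-basis = flip-rows E σ (λ x → entries-sign x z)
              (kernel-sign⇒locallyConstant G σ (λ x → entries-sign x z) (column-in-kernel E z sum≢0))

  open HadamardEigenbasis K-basis using () renaming (matrix to K; columns-orthogonal to K-orthogonal)

  ones : ∀ x → K x z ≡ + 1
  ones x = sign-square (entries-sign x z)

  ones-or-zero-sum : OnesOrZeroSum K
  ones-or-zero-sum y with y ≟ z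
  ... | yes refl = inj₁ ones
  ... | no y≢z   = inj₂ (begin
    ∑ (column K y)          ≡⟨ ∑-cong {n} (λ x → trans (sym (ℤ.*-identityˡ (K x y))) (cong (_* K x y) (sym (ones x)))) ⟩
    (transpose K ⊗ K) z y   ≡⟨ K-orthogonal z y ⟩
    + n * δ z y             ≡⟨ cong (+ n *_) (δ-≢ (y≢z ∘ sym)) ⟩
    + n * + 0               ≡⟨ ℤ.*-zeroʳ (+ n) ⟩
    + 0                     ∎)

normalize : ∀ {n} {G : Graph n} → HadamardEigenbasis G → NormalizedEigenbasis G
normalize {zero}  E = E , λ ()
normalize {suc k} E = uncurry (normalize-by-column E) (column-sum-nonzero E zero)

-- Kronecker and lexicographic products

module _ {m n : ℕ} where

  outer : Fin (m ℕ.* n) → Fin m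
  outer a = proj₁ (remQuot {m} n a)

  inner : Fin (m ℕ.* n) → Fin n
  inner a = proj₂ (remQuot {m} n a)

  _⊠ᵥ_ : (Fin m → ℤ) → (Fin n → ℤ) → Fin (m ℕ.* n) → ℤ
  (h ⊠ᵥ k) a = h (outer a) * k (inner a)

  _⊠_ : Matrix m → Matrix n → Matrix (m ℕ.* n)
  (A ⊠ B) a b = (column A (outer b) ⊠ᵥ column B (inner b)) a

  ⊠ᵥ-combine : (h : Fin m → ℤ) (k : Fin n → ℤ) → ∀ u x →
               (h ⊠ᵥ k) (combine {m} {n} u x) ≡ h u * k x
  ⊠ᵥ-combine h k u x = cong (λ p → h (proj₁ p) * k (proj₂ p)) (remQuot-combine {m} {n} u x)

  ∑-⊠ᵥ : (h : Fin m → ℤ) (k : Fin n → ℤ) → ∑ (h ⊠ᵥ k) ≡ ∑ h * ∑ k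
  ∑-⊠ᵥ h k = begin
    ∑ (h ⊠ᵥ k)                                            ≡⟨ ∑-combine {m} {n} (h ⊠ᵥ k) ⟩
    ∑ (λ u → ∑ (λ x → (h ⊠ᵥ k) (combine {m} {n} u x)))   ≡⟨ ∑-cong {m} (λ u → ∑-cong {n} (⊠ᵥ-combine h k u)) ⟩
    ∑ (λ u → ∑ (λ x → h u * k x))                         ≡⟨ ∑-*-∑ h k ⟨
    ∑ h * ∑ k                                             ∎

  δ-remQuot : (a b : Fin (m ℕ.* n)) → δ a b ≡ δ (outer a) (outer b) * δ (inner a) (inner b)
  δ-remQuot a b with a ≟ b
  ... | yes refl = sym (cong₂ _*_ (δ-refl (outer a)) (δ-refl (inner a)))
  ... | no a≢b with outer a ≟ outer b | inner a ≟ inner b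
  ...   | no _       | _          = refl
  ...   | yes _      | no _       = refl
  ...   | yes same-u | yes same-x = ⊥-elim (a≢b (begin
    a                               ≡⟨ combine-remQuot {m} n a ⟨
    combine (outer a) (inner a)     ≡⟨ cong₂ combine same-u same-x ⟩
    combine (outer b) (inner b)     ≡⟨ combine-remQuot {m} n b ⟩
    b                               ∎))

  ⊠-columns-orthogonal : (A : Matrix m) (B : Matrix n) →
                         (∀ i j → (transpose A ⊗ A) i j ≡ + m * δ i j) →
                         (∀ i j → (transpose B ⊗ B) i j ≡ + n * δ i j) →
                         ∀ a b → (transpose (A ⊠ B) ⊗ (A ⊠ B)) a b ≡ + (m ℕ.* n) * δ a b
  ⊠-columns-orthogonal A B A-orthogonal B-orthogonal a b = begin
    ∑ (λ c → (A ⊠ B) c a * (A ⊠ B) c b)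
      ≡⟨ ∑-cong {m ℕ.* n} (λ c → regroup (A (outer c) i) (B (inner c) x) (A (outer c) j) (B (inner c) y)) ⟩
    ∑ ((λ u → A u i * A u j) ⊠ᵥ (λ w → B w x * B w y))
      ≡⟨ ∑-⊠ᵥ (λ u → A u i * A u j) (λ w → B w x * B w y) ⟩
    (transpose A ⊗ A) i j * (transpose B ⊗ B) x y
      ≡⟨ cong₂ _*_ (A-orthogonal i j) (B-orthogonal x y) ⟩
    + m * δ i j * (+ n * δ x y)
      ≡⟨ regroup (+ m) (δ i j) (+ n) (δ x y) ⟩
    + m * + n * (δ i j * δ x y)
      ≡⟨ cong₂ _*_ (ℤ.pos-* m n) (δ-remQuot a b) ⟨
    + (m ℕ.* n) * δ a b
      ∎
    where
    i = outer a
    j = outer b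
    x = inner a
    y = inner b
    regroup : ∀ p q r s → p * q * (r * s) ≡ p * r * (q * s)
    regroup = solve-∀

  module _ (G₁ : Graph m) (G₂ : Graph n) where

    private
      A₁ = adjacency G₁
      A₂ = adjacency G₂
      A  = adjacency (G₁ ≀ G₂)

    adjacency-lex : ∀ a v y → A a (combine {m} {n} v y) ≡ A₁ (outer a) v + δ (outer a) v * A₂ (inner a) y
    adjacency-lex a v y = trans (cong (λ p → indicator (outer a) (proj₁ p) (inner a) (proj₂ p)) (remQuot-combine {m} {n} v y))
                                (indicator-split (outer a) v (inner a) y)
      where
      indicator : Fin m → Fin m → Fin n → Fin n → ℤ
      indicator u v x y = if adj G₁ u v ∨ (⌊ u ≟ v ⌋ ∧ adj G₂ x y) then + 1 else + 0

      indicator-split : ∀ u v x y → indicator u v x y ≡ A₁ u v + δ u v * A₂ x y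
      indicator-split u v x y with u ≟ v
      ... | yes refl rewrite adj-irrefl G₁ u with adj G₂ x y
      ...   | true  = refl
      ...   | false = refl
      indicator-split u v x y | no _ with adj G₁ u v
      ...   | true  = refl
      ...   | false = refl

    adjacency-lex-⊠ᵥ : (h : Fin m → ℤ) (k : Fin n → ℤ) → ∀ a →
                       (A *ᵥ (h ⊠ᵥ k)) a ≡ ∑ k * (A₁ *ᵥ h) (outer a) + h (outer a) * (A₂ *ᵥ k) (inner a)
    adjacency-lex-⊠ᵥ h k a = begin
      ∑ (λ c → A a c * (h ⊠ᵥ k) c)
        ≡⟨ ∑-combine {m} {n} _ ⟩
      ∑ (λ v → ∑ (λ y → A a (combine {m} {n} v y) * (h ⊠ᵥ k) (combine {m} {n} v y)))
        ≡⟨ ∑-cong {m} (λ v → ∑-cong {n} (λ y → cong₂ _*_ (adjacency-lex a v y) (⊠ᵥ-combine h k v y))) ⟩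
      ∑ (λ v → ∑ (λ y → (A₁ u v + δ u v * A₂ x y) * (h v * k y)))
        ≡⟨ ∑-cong {m} inner-sum ⟩
      ∑ (λ v → A₁ u v * h v * ∑ k + δ u v * (h v * (A₂ *ᵥ k) x))
        ≡⟨ ∑-distrib-+ {m} _ _ ⟩
      ∑ (λ v → A₁ u v * h v * ∑ k) + ∑ (λ v → δ u v * (h v * (A₂ *ᵥ k) x))
        ≡⟨ cong₂ _+_ (sym (*-distribʳ-∑ {m} (∑ k) _)) (∑-δˡ u (λ v → h v * (A₂ *ᵥ k) x)) ⟩
      (A₁ *ᵥ h) u * ∑ k + h u * (A₂ *ᵥ k) x
        ≡⟨ cong (_+ h u * (A₂ *ᵥ k) x) (ℤ.*-comm ((A₁ *ᵥ h) u) (∑ k)) ⟩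
      ∑ k * (A₁ *ᵥ h) u + h u * (A₂ *ᵥ k) x
        ∎
      where
      u = outer a
      x = inner a
      expand : ∀ a d b p q → (a + d * b) * (p * q) ≡ a * p * q + d * (p * (b * q))
      expand = solve-∀

      inner-sum : ∀ v → ∑ (λ y → (A₁ u v + δ u v * A₂ x y) * (h v * k y))
                        ≡ A₁ u v * h v * ∑ k + δ u v * (h v * (A₂ *ᵥ k) x)
      inner-sum v = begin
        ∑ (λ y → (A₁ u v + δ u v * A₂ x y) * (h v * k y))
          ≡⟨ ∑-cong {n} (λ y → expand (A₁ u v) (δ u v) (A₂ x y) (h v) (k y)) ⟩
        ∑ (λ y → A₁ u v * h v * k y + δ u v * (h v * (A₂ x y * k y)))
          ≡⟨ ∑-linear (A₁ u v * h v) (δ u v) k (λ y → h v * (A₂ x y * k y)) ⟩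
        A₁ u v * h v * ∑ k + δ u v * ∑ (λ y → h v * (A₂ x y * k y))
          ≡⟨ cong (λ s → A₁ u v * h v * ∑ k + δ u v * s) (*-distribˡ-∑ {n} (h v) _) ⟨
        A₁ u v * h v * ∑ k + δ u v * (h v * (A₂ *ᵥ k) x)
          ∎

    deg-lex : ∀ a → deg (G₁ ≀ G₂) a ≡ + n * deg G₁ (outer a) + deg G₂ (inner a)
    deg-lex a = begin
      deg (G₁ ≀ G₂) a                                 ≡⟨ adjacency-*ᵥ-ones (G₁ ≀ G₂) a ⟨
      (A *ᵥ (ones₁ ⊠ᵥ ones₂)) a                       ≡⟨ adjacency-lex-⊠ᵥ ones₁ ones₂ a ⟩
      ∑ ones₂ * (A₁ *ᵥ ones₁) u + + 1 * (A₂ *ᵥ ones₂) x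
        ≡⟨ cong₂ _+_ (cong₂ _*_ (trans (∑-const n (+ 1)) (ℤ.*-identityʳ (+ n))) (adjacency-*ᵥ-ones G₁ u))
                     (trans (ℤ.*-identityˡ _) (adjacency-*ᵥ-ones G₂ x)) ⟩
      + n * deg G₁ u + deg G₂ x                       ∎
      where
      u = outer a
      x = inner a
      ones₁ : Fin m → ℤ
      ones₁ _ = + 1
      ones₂ : Fin n → ℤ
      ones₂ _ = + 1

    laplacian-lex-⊠ᵥ : (h : Fin m → ℤ) (k : Fin n → ℤ) → ∀ a →
                       (laplacian (G₁ ≀ G₂) *ᵥ (h ⊠ᵥ k)) a
                       ≡ + n * deg G₁ (outer a) * (h ⊠ᵥ k) a - ∑ k * (A₁ *ᵥ h) (outer a)
                         + h (outer a) * (laplacian G₂ *ᵥ k) (inner a)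
    laplacian-lex-⊠ᵥ h k a = begin
      (laplacian (G₁ ≀ G₂) *ᵥ (h ⊠ᵥ k)) a
        ≡⟨ laplacian-*ᵥ (G₁ ≀ G₂) (h ⊠ᵥ k) a ⟩
      deg (G₁ ≀ G₂) a * (h u * k x) - (A *ᵥ (h ⊠ᵥ k)) a
        ≡⟨ cong₂ _-_ (cong (_* (h u * k x)) (deg-lex a)) (adjacency-lex-⊠ᵥ h k a) ⟩
      (+ n * deg G₁ u + deg G₂ x) * (h u * k x) - (∑ k * (A₁ *ᵥ h) u + h u * (A₂ *ᵥ k) x)
        ≡⟨ rearrange (+ n) (deg G₁ u) (deg G₂ x) (h u) (k x) (∑ k) ((A₁ *ᵥ h) u) ((A₂ *ᵥ k) x) ⟩
      + n * deg G₁ u * (h u * k x) - ∑ k * (A₁ *ᵥ h) u + h u * (deg G₂ x * k x - (A₂ *ᵥ k) x)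
        ≡⟨ cong (λ t → + n * deg G₁ u * (h u * k x) - ∑ k * (A₁ *ᵥ h) u + h u * t) (laplacian-*ᵥ G₂ k x) ⟨
      + n * deg G₁ u * (h u * k x) - ∑ k * (A₁ *ᵥ h) u + h u * (laplacian G₂ *ᵥ k) x
        ∎
      where
      u = outer a
      x = inner a
      rearrange : ∀ n d₁ d₂ p q s a₁ a₂ →
                  (n * d₁ + d₂) * (p * q) - (s * a₁ + p * a₂) ≡ n * d₁ * (p * q) - s * a₁ + p * (d₂ * q - a₂)
      rearrange = solve-∀

    laplacian-lex-⊠ᵥ-ones : (h : Fin m → ℤ) (k : Fin n → ℤ) → (∀ x → k x ≡ + 1) → ∀ a →
                            (laplacian (G₁ ≀ G₂) *ᵥ (h ⊠ᵥ k)) a ≡ + n * (laplacian G₁ *ᵥ h) (outer a) * k (inner a)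
    laplacian-lex-⊠ᵥ-ones h k k≡1 a = begin
      (laplacian (G₁ ≀ G₂) *ᵥ (h ⊠ᵥ k)) a
        ≡⟨ laplacian-lex-⊠ᵥ h k a ⟩
      + n * deg G₁ u * (h u * k x) - ∑ k * (A₁ *ᵥ h) u + h u * (laplacian G₂ *ᵥ k) x
        ≡⟨ cong₂ (λ c s → + n * deg G₁ u * (h u * c) - s * (A₁ *ᵥ h) u + h u * (laplacian G₂ *ᵥ k) x)
                 (k≡1 x) ∑k≡n ⟩
      + n * deg G₁ u * (h u * + 1) - + n * (A₁ *ᵥ h) u + h u * (laplacian G₂ *ᵥ k) x
        ≡⟨ cong (λ l → + n * deg G₁ u * (h u * + 1) - + n * (A₁ *ᵥ h) u + h u * l) L₂k≡0 ⟩
      + n * deg G₁ u * (h u * + 1) - + n * (A₁ *ᵥ h) u + h u * + 0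
        ≡⟨ factor (+ n) (deg G₁ u) (h u) ((A₁ *ᵥ h) u) ⟩
      + n * (deg G₁ u * h u - (A₁ *ᵥ h) u) * + 1
        ≡⟨ cong₂ (λ l c → + n * l * c) (laplacian-*ᵥ G₁ h u) (k≡1 x) ⟨
      + n * (laplacian G₁ *ᵥ h) u * k x
        ∎
      where
      u = outer a
      x = inner a
      ∑k≡n : ∑ k ≡ + n
      ∑k≡n = trans (∑-cong {n} k≡1) (trans (∑-const n (+ 1)) (ℤ.*-identityʳ (+ n)))
      L₂k≡0 : (laplacian G₂ *ᵥ k) x ≡ + 0
      L₂k≡0 = trans (∑-cong {n} (λ w → cong (laplacian G₂ x w *_) (k≡1 w))) (laplacian-*ᵥ-ones G₂ x)
      factor : ∀ n d p s → n * d * (p * + 1) - n * s + p * + 0 ≡ n * (d * p - s) * + 1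
      factor = solve-∀

    laplacian-lex-⊠ᵥ-balanced : (h : Fin m → ℤ) (k : Fin n → ℤ) → ∑ k ≡ + 0 → ∀ a →
                                (laplacian (G₁ ≀ G₂) *ᵥ (h ⊠ᵥ k)) a
                                ≡ + n * deg G₁ (outer a) * (h ⊠ᵥ k) a + h (outer a) * (laplacian G₂ *ᵥ k) (inner a)
    laplacian-lex-⊠ᵥ-balanced h k ∑k≡0 a = begin
      (laplacian (G₁ ≀ G₂) *ᵥ (h ⊠ᵥ k)) a
        ≡⟨ laplacian-lex-⊠ᵥ h k a ⟩
      + n * deg G₁ u * (h u * k x) - ∑ k * (A₁ *ᵥ h) u + h u * (laplacian G₂ *ᵥ k) x
        ≡⟨ cong (λ s → + n * deg G₁ u * (h u * k x) - s * (A₁ *ᵥ h) u + h u * (laplacian G₂ *ᵥ k) x) ∑k≡0 ⟩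
      + n * deg G₁ u * (h u * k x) - + 0 * (A₁ *ᵥ h) u + h u * (laplacian G₂ *ᵥ k) x
        ≡⟨ cong (_+ h u * (laplacian G₂ *ᵥ k) x) (ℤ.+-identityʳ (+ n * deg G₁ u * (h u * k x))) ⟩
      + n * deg G₁ u * (h u * k x) + h u * (laplacian G₂ *ᵥ k) x
        ∎
      where
      u = outer a
      x = inner a

    lex-eigenbasis : HadamardEigenbasis G₁ → NormalizedEigenbasis G₂ → HadamardEigenbasis (G₁ ≀ G₂)
    lex-eigenbasis E₁ (E₂ , ones-or-zero-sum) = record
      { matrix             = H ⊠ K
      ; eigenvalue         = eigenvalue
      ; entries-sign       = λ a b → sign-* (sign₁ (outer a) (outer b)) (sign₂ (inner a) (inner b))
      ; columns-orthogonal = ⊠-columns-orthogonal H K orthogonal₁ orthogonal₂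
      ; eigenvector        = eigen
      }
      where
      open HadamardEigenbasis E₁ using ()
        renaming (matrix to H; eigenvalue to μ; entries-sign to sign₁; columns-orthogonal to orthogonal₁; eigenvector to eigen₁)
      open HadamardEigenbasis E₂ using ()
        renaming (matrix to K; eigenvalue to κ; entries-sign to sign₂; columns-orthogonal to orthogonal₂; eigenvector to eigen₂)

      eigenvalue : Fin (m ℕ.* n) → ℤ
      eigenvalue b = [ (λ _ → + n * + n * μ v) , (λ _ → + m * (+ n * + n * deg G₁ v + κ y)) ]′ (ones-or-zero-sum y)
        where
        v = outer b
        y = inner b

      eigen : ∀ a b → + (m ℕ.* n) * (laplacian (G₁ ≀ G₂) ⊗ (H ⊠ K)) a b ≡ eigenvalue b * (H ⊠ K) a b
      eigen a b with ones-or-zero-sum (inner b)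
      ... | inj₁ ones = begin
        + (m ℕ.* n) * (laplacian (G₁ ≀ G₂) *ᵥ (h ⊠ᵥ k)) a
          ≡⟨ cong₂ _*_ (ℤ.pos-* m n) (laplacian-lex-⊠ᵥ-ones h k ones a) ⟩
        + m * + n * (+ n * (laplacian G₁ ⊗ H) u v * k x)
          ≡⟨ regroup (+ m) (+ n) _ (k x) ⟩
        + n * + n * (+ m * (laplacian G₁ ⊗ H) u v) * k x
          ≡⟨ cong (λ t → + n * + n * t * k x) (eigen₁ u v) ⟩
        + n * + n * (μ v * h u) * k x
          ≡⟨ regroup′ (+ n * + n) (μ v) (h u) (k x) ⟩
        + n * + n * μ v * (h u * k x)
          ∎
        where
        u = outer a
        x = inner a
        v = outer b
        h = column H v
        k = column K (inner b)
        regroup : ∀ m n l c → m * n * (n * l * c) ≡ n * n * (m * l) * c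
        regroup = solve-∀
        regroup′ : ∀ s e p c → s * (e * p) * c ≡ s * e * (p * c)
        regroup′ = solve-∀
      ... | inj₂ ∑k≡0 = begin
        + (m ℕ.* n) * (laplacian (G₁ ≀ G₂) *ᵥ (h ⊠ᵥ k)) a
          ≡⟨ cong₂ _*_ (ℤ.pos-* m n) (laplacian-lex-⊠ᵥ-balanced h k ∑k≡0 a) ⟩
        + m * + n * (+ n * deg G₁ u * (h u * k x) + h u * (laplacian G₂ ⊗ K) x y)
          ≡⟨ cong (λ d → + m * + n * (+ n * d * (h u * k x) + h u * (laplacian G₂ ⊗ K) x y)) (regular E₁ u v) ⟩
        + m * + n * (+ n * deg G₁ v * (h u * k x) + h u * (laplacian G₂ ⊗ K) x y)
          ≡⟨ regroup (+ m) (+ n) (deg G₁ v) (h u) (k x) _ ⟩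
        + m * (+ n * + n * deg G₁ v * (h u * k x) + h u * (+ n * (laplacian G₂ ⊗ K) x y))
          ≡⟨ cong (λ t → + m * (+ n * + n * deg G₁ v * (h u * k x) + h u * t)) (eigen₂ x y) ⟩
        + m * (+ n * + n * deg G₁ v * (h u * k x) + h u * (κ y * k x))
          ≡⟨ collect (+ m) (+ n * + n * deg G₁ v) (κ y) (h u) (k x) ⟩
        + m * (+ n * + n * deg G₁ v + κ y) * (h u * k x)
          ∎
        where
        u = outer a
        x = inner a
        v = outer b
        y = inner b
        h = column H v
        k = column K y
        regroup : ∀ m n d p c l → m * n * (n * d * (p * c) + p * l) ≡ m * (n * n * d * (p * c) + p * (n * l))
        regroup = solve-∀
        collect : ∀ m s e p c → m * (s * (p * c) + p * (e * c)) ≡ m * (s + e) * (p * c)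
        collect = solve-∀

mainTheorem5 : ∀ {m n} (G₁ : Graph m) (G₂ : Graph n) →
    HadamardDiagonalizable G₁ → HadamardDiagonalizable G₂ →
    HadamardDiagonalizable (G₁ ≀ G₂)
mainTheorem5 G₁ G₂ diagonalizable₁ diagonalizable₂ =
  eigenbasis⇒diagonalizable
    (lex-eigenbasis G₁ G₂ (diagonalizable⇒eigenbasis diagonalizable₁)
                          (normalize (diagonalizable⇒eigenbasis diagonalizable₂)))
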